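{- For $n\ge 0$ let $p_n^e$ (resp. $p_n^o$) denote the number of even (resp. odd) parity alternating permutations (PAPs) of $[n]=\{1,\dots,n\}$, with $p_0^e=1$ and $p_0^o=0$. Then for every $n\ge 1$, \[ p_n^e=\left\lfloor \tfrac{n-1}{2}\right\rfloor p_{n-1}^o+p_{n-1}^e,\qquad p_n^o=\left\lfloor \tfrac{n-1}{2}\right\rfloor p_{n-1}^e+p_{n-1}^o . \]
   Context: A permutation $\sigma$ of $[n]$, written in one-line notation, is a PAP if its entries alternate in parity and $\sigma(1)$ is odd; equivalently, $\sigma(i)\equiv i \pmod 2$ for all $i$. A permutation is even or odd according to its sign $(-1)^{n-c}$, where $c$ is the number of cycles in its disjoint cycle decomposition (fixed points counted as cycles). The empty permutation is an even PAP. -}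

module Defs where

open import Data.Nat using (ℕ; zero; suc; _∸_; _≤_; _≤?_; _*_; _+_; _/_; _%_)
open import Data.Fin using (Fin; toℕ) renaming (_≟_ to _≟ᶠ_)
open import Data.Fin.Properties using (all?)
open import Data.Vec using (Vec; []; _∷_; lookup)
open import Data.List using (List; []; _∷_; map; concatMap; length; filter)
open import Data.List using () renaming (allFin to allFinL)
open import Data.Product using (_×_)
open import Relation.Binary.PropositionalEquality using (_≡_)
open import Relation.Nullary using (Dec; yes; no)
open import Relation.Nullary.Decidable using (_×-dec_; _→-dec_)
open import Data.Nat using () renaming (_≟_ to _≟ℕ_)

-- A candidate permutation of [n] in one-line notation: the vector
-- (σ(1), …, σ(n)), with [n] encoded as Fin n (value j ∈ Fin n stands for j+1).
OneLine : ℕ → Set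
OneLine n = Vec (Fin n) n

allVecs : (m k : ℕ) → List (Vec (Fin m) k)
allVecs m zero    = [] ∷ []
allVecs m (suc k) = concatMap (λ x → map (x ∷_) (allVecs m k)) (allFinL m)

IsPerm : ∀ {n} → OneLine n → Set
IsPerm {n} σ = ∀ (i j : Fin n) → lookup σ i ≡ lookup σ j → i ≡ j

isPerm? : ∀ {n} (σ : OneLine n) → Dec (IsPerm σ)
isPerm? σ = all? λ i → all? λ j → (lookup σ i ≟ᶠ lookup σ j) →-dec (i ≟ᶠ j)

-- PAP: σ(i) ≡ i (mod 2) for all i ∈ [n]. With the 0-based encoding the
-- shift by 1 on both sides does not change the congruence.
IsPAP : ∀ {n} → OneLine n → Set
IsPAP {n} σ = ∀ (i : Fin n) → toℕ (lookup σ i) % 2 ≡ toℕ i % 2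

isPAP? : ∀ {n} (σ : OneLine n) → Dec (IsPAP σ)
isPAP? σ = all? λ i → (toℕ (lookup σ i) % 2) ≟ℕ (toℕ i % 2)

iter : ∀ {n} → OneLine n → ℕ → Fin n → Fin n
iter σ zero    i = i
iter σ (suc k) i = lookup σ (iter σ k i)

-- i is the smallest element of its cycle: every σ^k(i), 0 ≤ k < n, is ≥ i.
-- (For a permutation of [n] the orbit of i is {σ^k(i) : 0 ≤ k < n}.)
IsCycleMin : ∀ {n} → OneLine n → Fin n → Set
IsCycleMin {n} σ i = ∀ (k : Fin n) → toℕ i ≤ toℕ (iter σ (toℕ k) i)

isCycleMin? : ∀ {n} (σ : OneLine n) (i : Fin n) → Dec (IsCycleMin σ i)
isCycleMin? σ i = all? λ k → toℕ i ≤? toℕ (iter σ (toℕ k) i)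

-- number of cycles of σ (fixed points included) = number of cycle minima
cycles : ∀ {n} → OneLine n → ℕ
cycles {n} σ = length (filter (isCycleMin? σ) (allFinL n))

-- σ is even iff its sign (-1)^(n - c) is +1
IsEven : ∀ {n} → OneLine n → Set
IsEven {n} σ = (n ∸ cycles σ) % 2 ≡ 0

IsOdd : ∀ {n} → OneLine n → Set
IsOdd {n} σ = (n ∸ cycles σ) % 2 ≡ 1

isEven? : ∀ {n} (σ : OneLine n) → Dec (IsEven σ)
isEven? {n} σ = ((n ∸ cycles σ) % 2) ≟ℕ 0

isOdd? : ∀ {n} (σ : OneLine n) → Dec (IsOdd σ)
isOdd? {n} σ = ((n ∸ cycles σ) % 2) ≟ℕ 1

pe : ℕ → ℕ
pe n = length (filter (λ σ → isPerm? σ ×-dec (isPAP? σ ×-dec isEven? σ)) (allVecs n n))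

po : ℕ → ℕ
po n = length (filter (λ σ → isPerm? σ ×-dec (isPAP? σ ×-dec isOdd? σ)) (allVecs n n))

-- Every permutation σ of Fin (suc n) arises from exactly one pair (τ , j), τ a permutation of
-- Fin n, by inserting the new maximum n either as a fixed point (j = nothing) or into the cycle
-- of y right after y (j = just y). Then σ is a PAP iff τ is one and, in the second case,
-- y ≡ n (mod 2), which leaves ⌊n/2⌋ choices of y. A new fixed point adds both a point and a
-- cycle, so the sign (-1)^(n - c) is unchanged; splicing into a cycle keeps the number of cycles
-- and flips the sign. Hence the PAPs of sign b on Fin (suc n) are in bijection with the PAPs of
-- sign b on Fin n plus ⌊n/2⌋ copies of those of the opposite sign. Cycles are counted by their
-- minima, and the spliced-in maximum is never the minimum of its cycle.

module Submission where

open import Defs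
open import Data.Bool using (true; false; if_then_else_)
open import Data.Empty using (⊥)
open import Data.Fin using (Fin; toℕ; fromℕ; fromℕ<; inject₁; punchOut)
import Data.Fin as Fin
open import Data.Fin.Properties using (toℕ-inject₁; toℕ-fromℕ; toℕ<n; toℕ-fromℕ<; ≤fromℕ; inject₁ℕ<; pigeonhole; any?; injective⇒≤; punchOut-injective)
open import Data.List using (List; []; _∷_; _++_; [_]; map; filter; length; cartesianProduct; cartesianProductWith; concatMap; allFin; tabulate; _∷ʳ_)
open import Data.List.Membership.Propositional using (_∈_)
open import Data.List.Membership.Propositional.Properties using (∈-allFin; ∈-cartesianProductWith⁺; ∈-filter⁺; ∈-filter⁻; ∈-map⁺; ∈-map⁻; ∈-cartesianProduct⁺; ∈-cartesianProduct⁻; ∈-++⁺ˡ; ∈-++⁺ʳ; ∈-++⁻)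
open import Data.List.Membership.Propositional.Properties.WithK using (unique∧set⇒bag)
open import Data.List.Properties using (length-++; length-map; map-tabulate; filter-++; filter-≐; filter-accept; filter-reject; length-filter; length-tabulate)
open import Data.List.Relation.Binary.BagAndSetEquality using (_∼[_]_; set; ∼bag⇒↭)
open import Data.List.Relation.Binary.Permutation.Propositional.Properties using (↭-length)
import Data.List.Relation.Unary.All as All
open import Data.List.Relation.Unary.Any using (here)
open import Data.List.Relation.Unary.Unique.Propositional using (Unique; []; _∷_)
open import Data.List.Relation.Unary.Unique.Propositional.Properties using (cartesianProductWith⁺; cartesianProduct⁺; allFin⁺; filter⁺; map⁺; ++⁺)
open import Data.Maybe using (Maybe; nothing; just; fromMaybe)
import Data.Maybe as Maybe
open import Data.Maybe.Properties using (just-injective) renaming (≡-dec to ≡-decᴹ)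
open import Data.Nat using (ℕ; zero; suc; _+_; _*_; _∸_; _≤_; _<_; z≤n; s≤s; s≤s⁻¹; _%_; _/_; _≟_)
open import Data.Nat.DivMod using (m%n<n; m/n≡1+[m∸n]/n; m≡m%n+[m/n]*n)
open import Data.Nat.Properties using (+-identityʳ; +-comm; n<1+n; m<n⇒0<n∸m; ≤-trans; m∸n≤m; m+[n∸m]≡n; <⇒≤; <-≤-trans; 1+n≰n; ≤-reflexive; <⇒≱; +-∸-assoc; *-comm)
open import Data.Product using (_,_; _×_; ∃; proj₁; proj₂; uncurry)
open import Data.Sum using (_⊎_; inj₁; inj₂)
open import Data.Unit using (⊤; tt)
open import Data.Vec using (Vec; []; _∷_; lookup)
import Data.Vec as Vec
open import Data.Vec.Properties using (∷-injective; lookup∘tabulate; tabulate∘lookup; tabulate-cong)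
open import Function using (_∘_; id)
open import Function.Bundles using (mk⇔)
open import Function.Definitions using (Injective)
open import Level using (Level)
open import Relation.Binary.PropositionalEquality using (_≡_; _≢_; refl; cong; cong₂; trans; sym; subst; subst₂; module ≡-Reasoning)
open import Relation.Nullary using (Dec; does; yes; no; contradiction)
open import Relation.Nullary.Decidable using (_×-dec_)
open import Relation.Unary using (Pred; Decidable; _≐_)

private variable
  ℓ₁ ℓ₂ ℓ₃ p : Level
  A : Set ℓ₁
  B : Set ℓ₂
  C : Set ℓ₃
  n : ℕ

unique-set-equal⇒length≡ : {xs ys : List A} → Unique xs → Unique ys → xs ∼[ set ] ys → length xs ≡ length ys
unique-set-equal⇒length≡ ux uy xs≈ys = ↭-length (∼bag⇒↭ (unique∧set⇒bag ux uy xs≈ys))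

length-cartesianProduct : (xs : List A) (ys : List B) → length (cartesianProduct xs ys) ≡ length xs * length ys
length-cartesianProduct []       ys = refl
length-cartesianProduct (x ∷ xs) ys = begin
  length (map (x ,_) ys ++ cartesianProduct xs ys)
    ≡⟨ length-++ (map (x ,_) ys) ⟩
  length (map (x ,_) ys) + length (cartesianProduct xs ys)
    ≡⟨ cong₂ _+_ (length-map (x ,_) ys) (length-cartesianProduct xs ys) ⟩
  length ys + length xs * length ys ∎
  where open ≡-Reasoning

concatMap-map≡cartesianProductWith : (f : A → B → C) (xs : List A) (ys : List B) →
  concatMap (λ x → map (f x) ys) xs ≡ cartesianProductWith f xs ys
concatMap-map≡cartesianProductWith f []       ys = refl
concatMap-map≡cartesianProductWith f (x ∷ xs) ys = cong (map (f x) ys ++_) (concatMap-map≡cartesianProductWith f xs ys)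

allVecs-suc : ∀ m k → allVecs m (suc k) ≡ cartesianProductWith _∷_ (allFin m) (allVecs m k)
allVecs-suc m k = concatMap-map≡cartesianProductWith _∷_ (allFin m) (allVecs m k)

allVecs-unique : ∀ m k → Unique (allVecs m k)
allVecs-unique m zero    = All.[] ∷ []
allVecs-unique m (suc k) rewrite allVecs-suc m k =
  cartesianProductWith⁺ _∷_ ∷-injective (allFin⁺ m) (allVecs-unique m k)

∈-allVecs : ∀ {m k} (v : Vec (Fin m) k) → v ∈ allVecs m k
∈-allVecs []      = here refl
∈-allVecs {m} {suc k} (x ∷ v) rewrite allVecs-suc m k =
  ∈-cartesianProductWith⁺ _∷_ (∈-allFin x) (∈-allVecs v)

tabulate-∷ʳ : ∀ {n} (f : Fin (suc n) → A) → tabulate f ≡ tabulate (f ∘ inject₁) ∷ʳ f (fromℕ n)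
tabulate-∷ʳ {n = zero}  f = refl
tabulate-∷ʳ {n = suc n} f = cong (f Fin.zero ∷_) (tabulate-∷ʳ (f ∘ Fin.suc))

allFin-∷ʳ : ∀ n → allFin (suc n) ≡ map inject₁ (allFin n) ∷ʳ fromℕ n
allFin-∷ʳ n = trans (tabulate-∷ʳ id) (cong (_∷ʳ fromℕ n) (sym (map-tabulate id inject₁)))

length-filter-map : {P : Pred B p} (P? : Decidable P) (f : A → B) (xs : List A) →
  length (filter P? (map f xs)) ≡ length (filter (P? ∘ f) xs)
length-filter-map P? f []       = refl
length-filter-map P? f (x ∷ xs) with does (P? (f x))
... | true  = cong suc (length-filter-map P? f xs)
... | false = length-filter-map P? f xs

length-filter-allFin-suc : {P : Pred (Fin (suc n)) p} (P? : Decidable P) →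
  length (filter P? (allFin (suc n))) ≡ length (filter (P? ∘ inject₁) (allFin n)) + length (filter P? [ fromℕ n ])
length-filter-allFin-suc {n = n} P? = begin
  length (filter P? (allFin (suc n)))
    ≡⟨ cong (length ∘ filter P?) (allFin-∷ʳ n) ⟩
  length (filter P? (map inject₁ (allFin n) ∷ʳ fromℕ n))
    ≡⟨ cong length (filter-++ P? (map inject₁ (allFin n)) [ fromℕ n ]) ⟩
  length (filter P? (map inject₁ (allFin n)) ++ filter P? [ fromℕ n ])
    ≡⟨ length-++ (filter P? (map inject₁ (allFin n))) ⟩
  length (filter P? (map inject₁ (allFin n))) + last
    ≡⟨ cong (_+ last) (length-filter-map P? inject₁ (allFin n)) ⟩
  length (filter (P? ∘ inject₁) (allFin n)) + last ∎
  where
  open ≡-Reasoning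
  last = length (filter P? [ fromℕ n ])

suc-%2 : ∀ k → suc k % 2 ≡ 1 ∸ k % 2
suc-%2 zero          = refl
suc-%2 (suc zero)    = refl
suc-%2 (suc (suc k)) = suc-%2 k

suc-%2≢ : ∀ k → suc k % 2 ≢ k % 2
suc-%2≢ zero          ()
suc-%2≢ (suc zero)    ()
suc-%2≢ (suc (suc k)) = suc-%2≢ k

%2≤1 : ∀ k → k % 2 ≤ 1
%2≤1 k = s≤s⁻¹ (m%n<n k 2)

1∸-swap : ∀ {a b} → a ≤ 1 → b ≤ 1 → 1 ∸ a ≡ b → a ≡ 1 ∸ b
1∸-swap z≤n       z≤n       ()
1∸-swap z≤n       (s≤s z≤n) refl = refl
1∸-swap (s≤s z≤n) z≤n       refl = refl
1∸-swap (s≤s z≤n) (s≤s z≤n) ()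

parity : Fin n → ℕ
parity i = toℕ i % 2

parity-inject₁ : (x : Fin n) → parity (inject₁ x) ≡ parity x
parity-inject₁ x = cong (_% 2) (toℕ-inject₁ x)

parity-fromℕ : ∀ n → parity (fromℕ n) ≡ n % 2
parity-fromℕ n = cong (_% 2) (toℕ-fromℕ n)

hasParity? : ∀ r → Decidable (λ (y : Fin n) → parity y ≡ r)
hasParity? r y = parity y ≟ r

countParity : ℕ → ℕ → ℕ
countParity r n = length (filter (hasParity? r) (allFin n))

countParity-suc : ∀ r n → countParity r (suc n) ≡ countParity r n + length (filter (hasParity? r) [ fromℕ n ])
countParity-suc r n = trans (length-filter-allFin-suc (hasParity? r))
  (cong (_+ length (filter (hasParity? r) [ fromℕ n ]))
    (cong length (filter-≐ (hasParity? r ∘ inject₁) (hasParity? r) same (allFin n))))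
  where
  same : (λ y → parity (inject₁ y) ≡ r) ≐ (λ y → parity y ≡ r)
  same = (λ {y} → trans (sym (parity-inject₁ y))) , (λ {y} → trans (parity-inject₁ y))

countParity-half : ∀ m → countParity (m % 2) m ≡ m / 2
countParity-half zero          = refl
countParity-half (suc zero)    = refl
countParity-half (suc (suc k)) = begin
  countParity (k % 2) (suc (suc k))
    ≡⟨ countParity-suc (k % 2) (suc k) ⟩
  countParity (k % 2) (suc k) + length (filter (hasParity? (k % 2)) [ fromℕ (suc k) ])
    ≡⟨ cong₂ _+_ (countParity-suc (k % 2) k) (cong length (filter-reject (hasParity? (k % 2)) {fromℕ (suc k)} {[]}
         (suc-%2≢ k ∘ trans (sym (parity-fromℕ (suc k)))))) ⟩
  countParity (k % 2) k + length (filter (hasParity? (k % 2)) [ fromℕ k ]) + 0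
    ≡⟨ cong (λ l → countParity (k % 2) k + l + 0)
         (cong length (filter-accept (hasParity? (k % 2)) {fromℕ k} {[]} (parity-fromℕ k))) ⟩
  countParity (k % 2) k + 1 + 0
    ≡⟨ cong (λ c → c + 1 + 0) (countParity-half k) ⟩
  k / 2 + 1 + 0
    ≡⟨ trans (+-identityʳ (k / 2 + 1)) (+-comm (k / 2) 1) ⟩
  suc (k / 2)
    ≡⟨ m/n≡1+[m∸n]/n {suc (suc k)} {2} (s≤s (s≤s z≤n)) ⟨
  suc (suc k) / 2 ∎
  where
  open ≡-Reasoning

-- Iterates and cycle minima

iter-+ : (σ : OneLine n) (a b : ℕ) (i : Fin n) → iter σ (a + b) i ≡ iter σ a (iter σ b i)
iter-+ σ zero    b i = refl
iter-+ σ (suc a) b i = cong (lookup σ) (iter-+ σ a b i)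

iter-invariant : (σ : OneLine n) (P : Pred (Fin n) p) → (∀ {z} → P z → P (lookup σ z)) →
  ∀ {i} → P i → ∀ K → P (iter σ K i)
iter-invariant σ P step Pi zero    = Pi
iter-invariant σ P step Pi (suc K) = step (iter-invariant σ P step Pi K)

iter-injective : (σ : OneLine n) → IsPerm σ → ∀ K {i i′} → iter σ K i ≡ iter σ K i′ → i ≡ i′
iter-injective σ σ-perm zero    eq = eq
iter-injective σ σ-perm (suc K) eq = iter-injective σ σ-perm K (σ-perm _ _ eq)

period : (σ : OneLine n) → IsPerm σ → (i : Fin n) → ∃ λ d → 0 < d × d ≤ n × iter σ d i ≡ i
period {suc n} σ σ-perm i with a , b , a<b , eq ← pigeonhole (n<1+n (suc n)) (λ k → iter σ (toℕ k) i) =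
  toℕ b ∸ toℕ a , m<n⇒0<n∸m a<b , ≤-trans (m∸n≤m (toℕ b) (toℕ a)) (s≤s⁻¹ (toℕ<n b)) ,
  iter-injective σ σ-perm (toℕ a) (begin
    iter σ (toℕ a) (iter σ (toℕ b ∸ toℕ a) i) ≡⟨ iter-+ σ (toℕ a) (toℕ b ∸ toℕ a) i ⟨
    iter σ (toℕ a + (toℕ b ∸ toℕ a)) i        ≡⟨ cong (λ k → iter σ k i) (m+[n∸m]≡n (<⇒≤ a<b)) ⟩
    iter σ (toℕ b) i                          ≡⟨ eq ⟨
    iter σ (toℕ a) i ∎)
  where open ≡-Reasoning

iter-*-period : (σ : OneLine n) {i : Fin n} {d : ℕ} → iter σ d i ≡ i → ∀ q → iter σ (q * d) i ≡ i
iter-*-period σ {i} {d} fix zero    = refl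
iter-*-period σ {i} {d} fix (suc q) = trans (iter-+ σ d (q * d) i) (trans (cong (iter σ d) (iter-*-period σ fix q)) fix)

-- Unlike IsCycleMin, this ranges over all iterates: the form that transfers along insertMax.
IsOrbitMin : OneLine n → Fin n → Set
IsOrbitMin σ i = ∀ K → toℕ i ≤ toℕ (iter σ K i)

cycleMin⇒orbitMin : (σ : OneLine n) → IsPerm σ → ∀ {i} → IsCycleMin σ i → IsOrbitMin σ i
cycleMin⇒orbitMin {n} σ σ-perm {i} min K with period σ σ-perm i
... | d@(suc _) , _ , d≤n , fix = subst (λ z → toℕ i ≤ toℕ z) (sym iter-K≡iter-r)
  (subst (λ k → toℕ i ≤ toℕ (iter σ k i)) (toℕ-fromℕ< r<n) (min (fromℕ< r<n)))
  where
  r<n : K % d < n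
  r<n = <-≤-trans (m%n<n K d) d≤n
  iter-K≡iter-r : iter σ K i ≡ iter σ (K % d) i
  iter-K≡iter-r = begin
    iter σ K i                           ≡⟨ cong (λ k → iter σ k i) (m≡m%n+[m/n]*n K d) ⟩
    iter σ (K % d + K / d * d) i         ≡⟨ iter-+ σ (K % d) (K / d * d) i ⟩
    iter σ (K % d) (iter σ (K / d * d) i) ≡⟨ cong (iter σ (K % d)) (iter-*-period σ fix (K / d)) ⟩
    iter σ (K % d) i ∎
    where open ≡-Reasoning

cycles≤ : (σ : OneLine n) → cycles σ ≤ n
cycles≤ {n} σ = subst (cycles σ ≤_) (length-tabulate id) (length-filter (isCycleMin? σ) (allFin n))

perm-surjective : (σ : OneLine n) → IsPerm σ → ∀ t → ∃ λ i → lookup σ i ≡ t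
perm-surjective {suc n} σ σ-perm t with any? (λ i → lookup σ i Fin.≟ t)
... | yes hit  = hit
... | no  miss = contradiction (injective⇒≤ punched-injective) 1+n≰n
  where
  t≢σ : ∀ i → t ≢ lookup σ i
  t≢σ i t≡σi = miss (i , sym t≡σi)
  punched : Fin (suc n) → Fin n
  punched i = punchOut (t≢σ i)
  punched-injective : Injective _≡_ _≡_ punched
  punched-injective {i} {i′} eq = σ-perm i i′ (punchOut-injective (t≢σ i) (t≢σ i′) eq)

-- Fin (suc n) as Maybe (Fin n), nothing being the maximum

embed : Maybe (Fin n) → Fin (suc n)
embed nothing  = fromℕ _
embed (just x) = inject₁ x

embed⁻¹ : Fin (suc n) → Maybe (Fin n)
embed⁻¹ {zero}  Fin.zero    = nothing
embed⁻¹ {suc n} Fin.zero    = just Fin.zero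
embed⁻¹ {suc n} (Fin.suc i) = Maybe.map Fin.suc (embed⁻¹ i)

embed-embed⁻¹ : (i : Fin (suc n)) → embed (embed⁻¹ i) ≡ i
embed-embed⁻¹ {zero}  Fin.zero    = refl
embed-embed⁻¹ {suc n} Fin.zero    = refl
embed-embed⁻¹ {suc n} (Fin.suc i) with embed⁻¹ i | embed-embed⁻¹ i
... | nothing | eq = cong Fin.suc eq
... | just _  | eq = cong Fin.suc eq

embed⁻¹-embed : (o : Maybe (Fin n)) → embed⁻¹ (embed o) ≡ o
embed⁻¹-embed {zero}  nothing             = refl
embed⁻¹-embed {suc n} nothing             = cong (Maybe.map Fin.suc) (embed⁻¹-embed {n} nothing)
embed⁻¹-embed {suc n} (just Fin.zero)     = refl
embed⁻¹-embed {suc n} (just (Fin.suc x)) = cong (Maybe.map Fin.suc) (embed⁻¹-embed (just x))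

embed-injective : Injective _≡_ _≡_ (embed {n})
embed-injective {x = o} {o′} eq = trans (sym (embed⁻¹-embed o)) (trans (cong embed⁻¹ eq) (embed⁻¹-embed o′))

∀-embed : {P : Pred (Fin (suc n)) p} → (∀ o → P (embed o)) → ∀ i → P i
∀-embed {P = P} P∘embed i = subst P (embed-embed⁻¹ i) (P∘embed (embed⁻¹ i))

_≟ᴹ_ : (o o′ : Maybe (Fin n)) → Dec (o ≡ o′)
_≟ᴹ_ = ≡-decᴹ Fin._≟_

-- For j = just y the new point nothing is spliced into the cycle of y right after y;
-- for j = nothing it becomes a fixed point.
insertAt : (Fin n → Fin n) → Maybe (Fin n) → Maybe (Fin n) → Maybe (Fin n)
insertAt t nothing  o        = Maybe.map t o
insertAt t (just y) nothing  = just (t y)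
insertAt t (just y) (just x) = if does (x Fin.≟ y) then nothing else just (t x)

data InsertAtView (t : Fin n → Fin n) (j : Maybe (Fin n)) : Maybe (Fin n) → Maybe (Fin n) → Set where
  at-slot : InsertAtView t j j nothing
  at-new  : ∀ {y} → j ≡ just y → InsertAtView t j nothing (just (t y))
  at-old  : ∀ {x} → just x ≢ j → InsertAtView t j (just x) (just (t x))

insertAt-view : (t : Fin n → Fin n) (j o : Maybe (Fin n)) → InsertAtView t j o (insertAt t j o)
insertAt-view t nothing  nothing  = at-slot
insertAt-view t nothing  (just x) = at-old (λ ())
insertAt-view t (just y) nothing  = at-new refl
insertAt-view t (just y) (just x) with x Fin.≟ y
... | yes refl = at-slot
... | no  x≢y  = at-old (x≢y ∘ just-injective)

insertAt-slot : (t : Fin n → Fin n) (j : Maybe (Fin n)) → insertAt t j j ≡ nothing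
insertAt-slot t j with insertAt t j j | insertAt-view t j j
... | _ | at-slot   = refl
... | _ | at-new eq = contradiction eq λ ()
... | _ | at-old ne = contradiction refl ne

insertAt≡nothing : (t : Fin n → Fin n) (j : Maybe (Fin n)) {o : Maybe (Fin n)} → insertAt t j o ≡ nothing → o ≡ j
insertAt≡nothing t j {o} eq with insertAt t j o | insertAt-view t j o
insertAt≡nothing t j {o} refl | _ | at-slot = refl

insertAt-old : (t : Fin n → Fin n) {j : Maybe (Fin n)} {x : Fin n} →
  just x ≢ j → insertAt t j (just x) ≡ just (t x)
insertAt-old t {j} {x} ne with insertAt t j (just x) | insertAt-view t j (just x)
... | _ | at-slot  = contradiction refl ne
... | _ | at-old _ = refl

insertAt-injective : {t : Fin n → Fin n} → Injective _≡_ _≡_ t → ∀ j → Injective _≡_ _≡_ (insertAt t j)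
insertAt-injective {t = t} t-inj j {o} {o′} eq
  with insertAt t j o | insertAt-view t j o | insertAt t j o′ | insertAt-view t j o′
... | _ | at-slot    | _ | at-slot     = refl
... | _ | at-new e   | _ | at-new e′   = refl
... | _ | at-old ne  | _ | at-old ne′  = cong just (t-inj (just-injective eq))
... | _ | at-new e   | _ | at-old ne′  = contradiction (trans e (cong just (t-inj (just-injective eq)))) (ne′ ∘ sym)
... | _ | at-old ne  | _ | at-new e′   = contradiction (trans e′ (cong just (t-inj (just-injective (sym eq))))) (ne ∘ sym)
... | _ | at-slot    | _ | at-new e′   = contradiction eq λ ()
... | _ | at-slot    | _ | at-old ne′  = contradiction eq λ ()
... | _ | at-new e   | _ | at-slot     = contradiction eq λ ()
... | _ | at-old ne  | _ | at-slot     = contradiction eq λ ()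

insertAt-injective⁻ : (t : Fin n → Fin n) (j : Maybe (Fin n)) →
  Injective _≡_ _≡_ (insertAt t j) → Injective _≡_ _≡_ t
insertAt-injective⁻ t j inj {a} {b} eq with just a ≟ᴹ j | just b ≟ᴹ j
... | yes a-slot | yes b-slot = just-injective (trans a-slot (sym b-slot))
... | no  a-old  | no  b-old  =
  just-injective (inj (trans (insertAt-old t a-old) (trans (cong just eq) (sym (insertAt-old t b-old)))))
... | yes refl   | no  b-old  =
  contradiction (inj {nothing} {just b} (trans (cong just eq) (sym (insertAt-old t b-old)))) λ ()
... | no  a-old  | yes refl   =
  contradiction (inj {just a} {nothing} (trans (insertAt-old t a-old) (cong just eq))) λ ()

detach : (Maybe (Fin n) → Maybe (Fin n)) → Fin n → Fin n
detach u x = fromMaybe (fromMaybe x (u nothing)) (u (just x))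

detach-insertAt : (t : Fin n → Fin n) (j : Maybe (Fin n)) (x : Fin n) → detach (insertAt t j) x ≡ t x
detach-insertAt t j x with insertAt t j (just x) | insertAt-view t j (just x)
... | _ | at-slot  = refl
... | _ | at-old _ = refl

just-fromMaybe : {d : A} {o : Maybe A} → o ≢ nothing → just (fromMaybe d o) ≡ o
just-fromMaybe {o = nothing} o≢nothing = contradiction refl o≢nothing
just-fromMaybe {o = just _}  _         = refl

insertAt-detach : {u : Maybe (Fin n) → Maybe (Fin n)} → Injective _≡_ _≡_ u →
  ∀ {j} → u j ≡ nothing → ∀ o → insertAt (detach u) j o ≡ u o
insertAt-detach {u = u} u-inj {j} uj≡nothing o with insertAt (detach u) j o | insertAt-view (detach u) j o
... | _ | at-slot         = sym uj≡nothing
... | _ | at-new {y} refl = trans (cong (just ∘ fromMaybe (fromMaybe y (u nothing))) uj≡nothing)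
  (just-fromMaybe λ eq → contradiction (u-inj (trans eq (sym uj≡nothing))) λ ())
... | _ | at-old ne       = just-fromMaybe λ eq → ne (u-inj (trans eq (sym uj≡nothing)))

SlotParity : Maybe (Fin n) → Set
SlotParity     nothing  = ⊤
SlotParity {n} (just y) = parity y ≡ n % 2

insertAt-parity : {n : ℕ} (t : Fin n → Fin n) (j : Maybe (Fin n)) →
  (∀ x → parity (t x) ≡ parity x) → SlotParity j → ∀ o → parity (embed (insertAt t j o)) ≡ parity (embed o)
insertAt-parity {n} t j t-par j-par o with insertAt t j o | insertAt-view t j o
insertAt-parity {n} t nothing  t-par _     o | _ | at-slot = refl
insertAt-parity {n} t (just y) t-par y-par o | _ | at-slot = trans (parity-fromℕ n) (sym (trans (parity-inject₁ y) y-par))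
insertAt-parity {n} t j        t-par y-par o | _ | at-new {y} refl =
  trans (parity-inject₁ (t y)) (trans (t-par y) (trans y-par (sym (parity-fromℕ n))))
insertAt-parity {n} t j        t-par _     o | _ | at-old {x} _    =
  trans (parity-inject₁ (t x)) (trans (t-par x) (sym (parity-inject₁ x)))

insertAt-parity⁻ : {n : ℕ} (t : Fin n → Fin n) (j : Maybe (Fin n)) →
  (∀ o → parity (embed (insertAt t j o)) ≡ parity (embed o)) → (∀ x → parity (t x) ≡ parity x) × SlotParity j
insertAt-parity⁻ {n} t j preserved = t-parity , slot-parity j refl
  where
  slot-parity : ∀ j′ → j′ ≡ j → SlotParity j′
  slot-parity nothing  _    = tt
  slot-parity (just y) refl = sym (begin
    n % 2                                 ≡⟨ parity-fromℕ n ⟨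
    parity (embed {n} nothing)            ≡⟨ cong (parity ∘ embed) (insertAt-slot t j) ⟨
    parity (embed (insertAt t j (just y))) ≡⟨ preserved (just y) ⟩
    parity (embed (just y))               ≡⟨ parity-inject₁ y ⟩
    parity y ∎)
    where open ≡-Reasoning
  t-parity : ∀ x → parity (t x) ≡ parity x
  t-parity x with just x ≟ᴹ j
  ... | yes refl  = trans (sym (parity-inject₁ (t x)))
    (trans (preserved nothing) (trans (parity-fromℕ n) (sym (slot-parity j refl))))
  ... | no  x-old = trans (sym (parity-inject₁ (t x)))
    (trans (cong (parity ∘ embed) (sym (insertAt-old t x-old))) (trans (preserved (just x)) (parity-inject₁ x)))

-- Inserting the maximum into a permutation

insertMax : OneLine n → Maybe (Fin n) → OneLine (suc n)
insertMax τ j = Vec.tabulate (embed ∘ insertAt (lookup τ) j ∘ embed⁻¹)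

lookup-insertMax : (τ : OneLine n) (j o : Maybe (Fin n)) →
  lookup (insertMax τ j) (embed o) ≡ embed (insertAt (lookup τ) j o)
lookup-insertMax τ j o = trans (lookup∘tabulate (embed ∘ insertAt (lookup τ) j ∘ embed⁻¹) (embed o))
  (cong (embed ∘ insertAt (lookup τ) j) (embed⁻¹-embed o))

module _ (τ : OneLine n) (j : Maybe (Fin n)) where

  private
    σ = insertMax τ j
    t = lookup τ

  insertMax-perm : IsPerm τ → IsPerm σ
  insertMax-perm τ-perm = ∀-embed {P = λ i → ∀ i′ → lookup σ i ≡ lookup σ i′ → i ≡ i′} λ o →
    ∀-embed {P = λ i′ → lookup σ (embed o) ≡ lookup σ i′ → embed o ≡ i′} λ o′ eq →
      cong embed (insertAt-injective (τ-perm _ _) j (embed-injective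
        (trans (sym (lookup-insertMax τ j o)) (trans eq (lookup-insertMax τ j o′)))))

  insertMax-perm⁻ : IsPerm σ → IsPerm τ
  insertMax-perm⁻ σ-perm a b = insertAt-injective⁻ t j (λ {o} {o′} eq → embed-injective (σ-perm (embed o) (embed o′)
    (trans (lookup-insertMax τ j o) (trans (cong embed eq) (sym (lookup-insertMax τ j o′))))))

  insertMax-PAP : IsPAP τ → SlotParity j → IsPAP σ
  insertMax-PAP τ-pap j-par = ∀-embed λ o →
    trans (cong parity (lookup-insertMax τ j o)) (insertAt-parity t j τ-pap j-par o)

  insertMax-PAP⁻ : IsPAP σ → IsPAP τ × SlotParity j
  insertMax-PAP⁻ σ-pap = insertAt-parity⁻ t j λ o →
    trans (cong parity (sym (lookup-insertMax τ j o))) (σ-pap (embed o))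

  private
    Visits : Fin n → Fin (suc n) → Set
    Visits x z = (∃ λ K → z ≡ inject₁ (iter τ K x)) ⊎ (z ≡ fromℕ n × ∃ λ K → j ≡ just (iter τ K x))

    visits-step : ∀ {x z} → Visits x z → Visits x (lookup σ z)
    visits-step {x} (inj₁ (K , refl)) with just (iter τ K x) ≟ᴹ j
    ... | yes at-j = inj₂ (trans (lookup-insertMax τ j (just (iter τ K x)))
                            (cong embed (trans (cong (insertAt t j) at-j) (insertAt-slot t j))) , K , sym at-j)
    ... | no  ne   = inj₁ (suc K , trans (lookup-insertMax τ j (just (iter τ K x))) (cong embed (insertAt-old t ne)))
    visits-step {x} (inj₂ (refl , K , at-j)) =
      inj₁ (suc K , trans (lookup-insertMax τ j nothing) (cong (λ j′ → embed (insertAt t j′ nothing)) at-j))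

    reach-step : ∀ w → ∃ λ k → iter σ k (inject₁ w) ≡ inject₁ (t w)
    reach-step w with just w ≟ᴹ j
    ... | no  ne   = 1 , trans (lookup-insertMax τ j (just w)) (cong embed (insertAt-old t ne))
    ... | yes at-w = 2 , (begin
      lookup σ (lookup σ (embed (just w)))
        ≡⟨ cong (lookup σ) (lookup-insertMax τ j (just w)) ⟩
      lookup σ (embed (insertAt t j (just w)))
        ≡⟨ cong (lookup σ ∘ embed) (trans (cong (insertAt t j) at-w) (insertAt-slot t j)) ⟩
      lookup σ (embed nothing)
        ≡⟨ lookup-insertMax τ j nothing ⟩
      embed (insertAt t j nothing)
        ≡⟨ cong (λ j′ → embed (insertAt t j′ nothing)) (sym at-w) ⟩
      inject₁ (t w) ∎)
      where open ≡-Reasoning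

  orbitMin-insertMax : ∀ x → IsOrbitMin τ x → IsOrbitMin σ (inject₁ x)
  orbitMin-insertMax x min K with iter-invariant σ (Visits x) visits-step (inj₁ (0 , refl)) K
  ... | inj₁ (K′ , eq) =
    subst₂ _≤_ (sym (toℕ-inject₁ x)) (trans (sym (toℕ-inject₁ _)) (cong toℕ (sym eq))) (min K′)
  ... | inj₂ (eq , _)  = subst (λ z → toℕ (inject₁ x) ≤ toℕ z) (sym eq) (≤fromℕ (inject₁ x))

  orbitMin-insertMax⁻ : ∀ x → IsOrbitMin σ (inject₁ x) → IsOrbitMin τ x
  orbitMin-insertMax⁻ x min K with iter-invariant τ Reached step (0 , refl) K
    where
    Reached : Fin n → Set
    Reached z = ∃ λ k → iter σ k (inject₁ x) ≡ inject₁ z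
    step : ∀ {z} → Reached z → Reached (t z)
    step {z} (k , eq) with k′ , eq′ ← reach-step z =
      k′ + k , trans (iter-+ σ k′ k (inject₁ x)) (trans (cong (iter σ k′) eq) eq′)
  ... | k , eq = subst₂ _≤_ (toℕ-inject₁ x) (trans (cong toℕ eq) (toℕ-inject₁ _)) (min k)

newCycle : Maybe (Fin n) → ℕ
newCycle nothing  = 1
newCycle (just _) = 0

length-filter-cycleMin-max : (τ : OneLine n) (j : Maybe (Fin n)) → IsPerm τ →
  length (filter (isCycleMin? (insertMax τ j)) [ fromℕ n ]) ≡ newCycle j
length-filter-cycleMin-max {n} τ nothing τ-perm = cong length (filter-accept (isCycleMin? σ) {xs = []} max-min)
  where
  σ = insertMax τ nothing
  max-min : IsCycleMin σ (fromℕ n)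
  max-min k = ≤-reflexive (cong toℕ (sym (iter-invariant σ (_≡ fromℕ n)
    (λ eq → trans (cong (lookup σ) eq) (lookup-insertMax τ nothing nothing)) refl (toℕ k))))
length-filter-cycleMin-max {n} τ (just y) τ-perm = cong length (filter-reject (isCycleMin? σ) {xs = []} λ max-min →
  <⇒≱ max-moves-down (cycleMin⇒orbitMin σ (insertMax-perm τ (just y) τ-perm) max-min 1))
  where
  σ = insertMax τ (just y)
  max-moves-down : toℕ (lookup σ (fromℕ n)) < toℕ (fromℕ n)
  max-moves-down = subst₂ _<_ (cong toℕ (sym (lookup-insertMax τ (just y) nothing))) (sym (toℕ-fromℕ n))
    (inject₁ℕ< (lookup τ y))

orbitMin⇒cycleMin : (σ : OneLine n) {i : Fin n} → IsOrbitMin σ i → IsCycleMin σ i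
orbitMin⇒cycleMin σ min k = min (toℕ k)

cycles-insertMax : (τ : OneLine n) (j : Maybe (Fin n)) → IsPerm τ → cycles (insertMax τ j) ≡ newCycle j + cycles τ
cycles-insertMax {n} τ j τ-perm = begin
  cycles σ
    ≡⟨ length-filter-allFin-suc (isCycleMin? σ) ⟩
  length (filter (isCycleMin? σ ∘ inject₁) (allFin n)) + length (filter (isCycleMin? σ) [ fromℕ n ])
    ≡⟨ cong₂ _+_ (cong length (filter-≐ (isCycleMin? σ ∘ inject₁) (isCycleMin? τ) same-minima (allFin n)))
                 (length-filter-cycleMin-max τ j τ-perm) ⟩
  cycles τ + newCycle j
    ≡⟨ +-comm (cycles τ) (newCycle j) ⟩
  newCycle j + cycles τ ∎
  where
  open ≡-Reasoning
  σ = insertMax τ j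
  same-minima : (IsCycleMin σ ∘ inject₁) ≐ IsCycleMin τ
  same-minima =
    (λ {x} → orbitMin⇒cycleMin τ ∘ orbitMin-insertMax⁻ τ j x ∘ cycleMin⇒orbitMin σ (insertMax-perm τ j τ-perm)) ,
    (λ {x} → orbitMin⇒cycleMin σ ∘ orbitMin-insertMax τ j x ∘ cycleMin⇒orbitMin τ τ-perm)

lookup-extensionality : {u v : Vec A n} → (∀ i → lookup u i ≡ lookup v i) → u ≡ v
lookup-extensionality {u = u} {v} eq = trans (sym (tabulate∘lookup u)) (trans (tabulate-cong eq) (tabulate∘lookup v))

insertAt-cong : {t t′ : Fin n → Fin n} → (∀ x → t x ≡ t′ x) → ∀ j o → insertAt t j o ≡ insertAt t′ j o
insertAt-cong eq nothing  nothing  = refl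
insertAt-cong eq nothing  (just x) = cong just (eq x)
insertAt-cong eq (just y) nothing  = cong just (eq y)
insertAt-cong eq (just y) (just x) with x Fin.≟ y
... | yes _ = refl
... | no  _ = cong just (eq x)

insertMax-injective : {τ τ′ : OneLine n} {j j′ : Maybe (Fin n)} →
  insertMax τ j ≡ insertMax τ′ j′ → τ ≡ τ′ × j ≡ j′
insertMax-injective {τ = τ} {τ′} {j} {j′} eq = lookup-extensionality same-τ , same-j
  where
  same-insertAt : ∀ o → insertAt (lookup τ) j o ≡ insertAt (lookup τ′) j′ o
  same-insertAt o = embed-injective (trans (sym (lookup-insertMax τ j o))
    (trans (cong (λ σ → lookup σ (embed o)) eq) (lookup-insertMax τ′ j′ o)))
  same-j : j ≡ j′
  same-j = insertAt≡nothing (lookup τ′) j′ (trans (sym (same-insertAt j)) (insertAt-slot (lookup τ) j))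
  same-τ : ∀ x → lookup τ x ≡ lookup τ′ x
  same-τ x = begin
    lookup τ x
      ≡⟨ detach-insertAt (lookup τ) j x ⟨
    detach (insertAt (lookup τ) j) x
      ≡⟨ cong₂ (λ a b → fromMaybe (fromMaybe x a) b) (same-insertAt nothing) (same-insertAt (just x)) ⟩
    detach (insertAt (lookup τ′) j′) x
      ≡⟨ detach-insertAt (lookup τ′) j′ x ⟩
    lookup τ′ x ∎
    where open ≡-Reasoning

insertMax-surjective : (σ : OneLine (suc n)) → IsPerm σ →
  ∃ λ ((τ , j) : OneLine n × Maybe (Fin n)) → insertMax τ j ≡ σ
insertMax-surjective {n} σ σ-perm with p , σp≡max ← perm-surjective σ σ-perm (fromℕ n) =
  (τ , j) , lookup-extensionality (∀-embed λ o → begin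
    lookup (insertMax τ j) (embed o)   ≡⟨ lookup-insertMax τ j o ⟩
    embed (insertAt (lookup τ) j o)    ≡⟨ cong embed (insertAt-cong (lookup∘tabulate (detach u)) j o) ⟩
    embed (insertAt (detach u) j o)    ≡⟨ cong embed (insertAt-detach u-injective {j} uj≡nothing o) ⟩
    embed (u o)                        ≡⟨ embed-embed⁻¹ (lookup σ (embed o)) ⟩
    lookup σ (embed o) ∎)
  where
  open ≡-Reasoning
  u : Maybe (Fin n) → Maybe (Fin n)
  u o = embed⁻¹ (lookup σ (embed o))
  u-injective : Injective _≡_ _≡_ u
  u-injective {o} {o′} eq = embed-injective (σ-perm (embed o) (embed o′)
    (trans (sym (embed-embed⁻¹ _)) (trans (cong embed eq) (embed-embed⁻¹ _))))
  j = embed⁻¹ p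
  τ = Vec.tabulate (detach u)
  uj≡nothing : u j ≡ nothing
  uj≡nothing = trans (cong (embed⁻¹ ∘ lookup σ) (embed-embed⁻¹ p))
    (trans (cong embed⁻¹ σp≡max) (embed⁻¹-embed nothing))

-- Counting PAPs by sign

sign : OneLine n → ℕ
sign {n} σ = (n ∸ cycles σ) % 2

SignedPAP : ℕ → OneLine n → Set
SignedPAP b σ = IsPerm σ × (IsPAP σ × sign σ ≡ b)

signedPAP? : ∀ b → Decidable (SignedPAP {n} b)
signedPAP? b σ = isPerm? σ ×-dec (isPAP? σ ×-dec (sign σ ≟ b))

paps : ∀ n → ℕ → List (OneLine n)
paps n b = filter (signedPAP? b) (allVecs n n)

∈-paps⁺ : {σ : OneLine n} {b : ℕ} → SignedPAP b σ → σ ∈ paps n b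
∈-paps⁺ {σ = σ} {b} = ∈-filter⁺ (signedPAP? b) (∈-allVecs σ)

∈-paps⁻ : {σ : OneLine n} {b : ℕ} → σ ∈ paps n b → SignedPAP b σ
∈-paps⁻ {n} {b = b} = proj₂ ∘ ∈-filter⁻ (signedPAP? b) {xs = allVecs n n}

paps-unique : ∀ n b → Unique (paps n b)
paps-unique n b = filter⁺ (signedPAP? b) (allVecs-unique n n)

sign-insertMax-nothing : (τ : OneLine n) → IsPerm τ → sign (insertMax τ nothing) ≡ sign τ
sign-insertMax-nothing {n} τ τ-perm = cong (λ c → (suc n ∸ c) % 2) (cycles-insertMax τ nothing τ-perm)

sign-insertMax-just : (τ : OneLine n) (y : Fin n) → IsPerm τ → sign (insertMax τ (just y)) ≡ 1 ∸ sign τ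
sign-insertMax-just {n} τ y τ-perm = begin
  (suc n ∸ cycles (insertMax τ (just y))) % 2 ≡⟨ cong (λ c → (suc n ∸ c) % 2) (cycles-insertMax τ (just y) τ-perm) ⟩
  (suc n ∸ cycles τ) % 2                      ≡⟨ cong (_% 2) (+-∸-assoc 1 (cycles≤ τ)) ⟩
  suc (n ∸ cycles τ) % 2                      ≡⟨ suc-%2 (n ∸ cycles τ) ⟩
  1 ∸ sign τ ∎
  where open ≡-Reasoning

slotSign : Maybe (Fin n) → ℕ → ℕ
slotSign nothing  b = b
slotSign (just _) b = 1 ∸ b

sign-insertMax : (τ : OneLine n) → IsPerm τ → ∀ {b} → b ≤ 1 → ∀ j →
  sign (insertMax τ j) ≡ b → sign τ ≡ slotSign j b
sign-insertMax     τ τ-perm b≤1 nothing  eq = trans (sym (sign-insertMax-nothing τ τ-perm)) eq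
sign-insertMax {n} τ τ-perm b≤1 (just y) eq =
  1∸-swap (%2≤1 (n ∸ cycles τ)) b≤1 (trans (sym (sign-insertMax-just τ y τ-perm)) eq)

sign-insertMax⁻ : (τ : OneLine n) → IsPerm τ → ∀ {b} → b ≤ 1 → ∀ j →
  sign τ ≡ slotSign j b → sign (insertMax τ j) ≡ b
sign-insertMax⁻     τ τ-perm b≤1 nothing  eq = trans (sign-insertMax-nothing τ τ-perm) eq
sign-insertMax⁻ {n} τ τ-perm b≤1 (just y) eq =
  trans (sign-insertMax-just τ y τ-perm) (sym (1∸-swap b≤1 (%2≤1 (n ∸ cycles τ)) (sym eq)))

Admissible : ℕ → OneLine n × Maybe (Fin n) → Set
Admissible b (τ , j) = SignedPAP (slotSign j b) τ × SlotParity j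

insertMax-signedPAP : ∀ {b} → b ≤ 1 → {τ : OneLine n} {j : Maybe (Fin n)} →
  Admissible b (τ , j) → SignedPAP b (insertMax τ j)
insertMax-signedPAP b≤1 {τ} {j} ((τ-perm , τ-pap , τ-sign) , j-par) =
  insertMax-perm τ j τ-perm , insertMax-PAP τ j τ-pap j-par , sign-insertMax⁻ τ τ-perm b≤1 j τ-sign

insertMax-signedPAP⁻ : ∀ {b} → b ≤ 1 → {τ : OneLine n} {j : Maybe (Fin n)} →
  SignedPAP b (insertMax τ j) → Admissible b (τ , j)
insertMax-signedPAP⁻ b≤1 {τ} {j} (σ-perm , σ-pap , σ-sign) =
  (τ-perm , τ-pap , sign-insertMax τ τ-perm b≤1 j σ-sign) , j-par
  where
  τ-perm = insertMax-perm⁻ τ j σ-perm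
  τ-pap = proj₁ (insertMax-PAP⁻ τ j σ-pap)
  j-par = proj₂ (insertMax-PAP⁻ τ j σ-pap)

sameParitySlots : ∀ n → List (Fin n)
sameParitySlots n = filter (hasParity? (n % 2)) (allFin n)

extensions : ∀ n → ℕ → List (OneLine n × Maybe (Fin n))
extensions n b = map (_, nothing) (paps n b) ++ cartesianProduct (paps n (1 ∸ b)) (map just (sameParitySlots n))

∈-extensions⁺ : ∀ {b} {p@(τ , j) : OneLine n × Maybe (Fin n)} → Admissible b p → p ∈ extensions n b
∈-extensions⁺ {p = τ , nothing} (τ-signed , _) = ∈-++⁺ˡ (∈-map⁺ (_, nothing) (∈-paps⁺ τ-signed))
∈-extensions⁺ {n} {p = τ , just y} (τ-signed , y-par) = ∈-++⁺ʳ _ (∈-cartesianProduct⁺ (∈-paps⁺ τ-signed)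
  (∈-map⁺ just (∈-filter⁺ (hasParity? (n % 2)) (∈-allFin y) y-par)))

∈-extensions⁻ : ∀ {b} {p : OneLine n × Maybe (Fin n)} → p ∈ extensions n b → Admissible b p
∈-extensions⁻ {n} {b} p∈ with ∈-++⁻ (map (_, nothing) (paps n b)) p∈
... | inj₁ p∈fixed with _ , τ∈ , refl ← ∈-map⁻ (_, nothing) p∈fixed = ∈-paps⁻ τ∈ , tt
... | inj₂ p∈moved with τ∈ , j∈ ← ∈-cartesianProduct⁻ (paps n (1 ∸ b)) _ p∈moved
                   with y , y∈ , refl ← ∈-map⁻ just j∈ =
  ∈-paps⁻ τ∈ , proj₂ (∈-filter⁻ (hasParity? (n % 2)) {xs = allFin n} y∈)

extensions-unique : ∀ n b → Unique (extensions n b)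
extensions-unique n b = ++⁺ (map⁺ (cong proj₁) (paps-unique n b))
  (cartesianProduct⁺ (paps-unique n (1 ∸ b)) (map⁺ just-injective (filter⁺ (hasParity? (n % 2)) (allFin⁺ n))))
  λ (p∈fixed , p∈moved) → nothing-∉ p∈fixed p∈moved
  where
  nothing-∉ : ∀ {p} → p ∈ map (_, nothing) (paps n b) →
    p ∈ cartesianProduct (paps n (1 ∸ b)) (map just (sameParitySlots n)) → ⊥
  nothing-∉ p∈fixed p∈moved with _ , _ , refl ← ∈-map⁻ (_, nothing) p∈fixed
    with _ , j∈ ← ∈-cartesianProduct⁻ (paps n (1 ∸ b)) _ p∈moved
    with _ , _ , () ← ∈-map⁻ just j∈

length-extensions : ∀ n b → length (extensions n b) ≡ n / 2 * length (paps n (1 ∸ b)) + length (paps n b)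
length-extensions n b = begin
  length (map (_, nothing) (paps n b) ++ cartesianProduct (paps n (1 ∸ b)) (map just (sameParitySlots n)))
    ≡⟨ length-++ (map (_, nothing) (paps n b)) ⟩
  length (map (_, nothing) (paps n b)) + length (cartesianProduct (paps n (1 ∸ b)) (map just (sameParitySlots n)))
    ≡⟨ cong₂ _+_ (length-map (_, nothing) (paps n b)) (length-cartesianProduct (paps n (1 ∸ b)) _) ⟩
  length (paps n b) + length (paps n (1 ∸ b)) * length (map just (sameParitySlots n))
    ≡⟨ cong (λ k → length (paps n b) + length (paps n (1 ∸ b)) * k)
         (trans (length-map just (sameParitySlots n)) (countParity-half n)) ⟩
  length (paps n b) + length (paps n (1 ∸ b)) * (n / 2)
    ≡⟨ +-comm (length (paps n b)) _ ⟩
  length (paps n (1 ∸ b)) * (n / 2) + length (paps n b)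
    ≡⟨ cong (_+ length (paps n b)) (*-comm (length (paps n (1 ∸ b))) (n / 2)) ⟩
  n / 2 * length (paps n (1 ∸ b)) + length (paps n b) ∎
  where open ≡-Reasoning

length-paps-suc : ∀ n {b} → b ≤ 1 → length (paps (suc n) b) ≡ n / 2 * length (paps n (1 ∸ b)) + length (paps n b)
length-paps-suc n {b} b≤1 = begin
  length (paps (suc n) b)
    ≡⟨ unique-set-equal⇒length≡ (paps-unique (suc n) b) insertions-unique (mk⇔ to from) ⟩
  length (map (uncurry insertMax) (extensions n b))
    ≡⟨ length-map (uncurry insertMax) (extensions n b) ⟩
  length (extensions n b)
    ≡⟨ length-extensions n b ⟩
  n / 2 * length (paps n (1 ∸ b)) + length (paps n b) ∎
  where
  open ≡-Reasoning
  insertions-unique : Unique (map (uncurry insertMax) (extensions n b))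
  insertions-unique = map⁺ (λ eq → uncurry (cong₂ _,_) (insertMax-injective eq)) (extensions-unique n b)
  to : ∀ {σ} → σ ∈ paps (suc n) b → σ ∈ map (uncurry insertMax) (extensions n b)
  to {σ} σ∈ with σ-signed@(σ-perm , _) ← ∈-paps⁻ σ∈ with (τ , j) , refl ← insertMax-surjective σ σ-perm =
    ∈-map⁺ (uncurry insertMax) (∈-extensions⁺ {p = τ , j} (insertMax-signedPAP⁻ b≤1 {τ} {j} σ-signed))
  from : ∀ {σ} → σ ∈ map (uncurry insertMax) (extensions n b) → σ ∈ paps (suc n) b
  from σ∈ with _ , p∈ , refl ← ∈-map⁻ (uncurry insertMax) σ∈ =
    ∈-paps⁺ (insertMax-signedPAP b≤1 (∈-extensions⁻ p∈))

theorem2 : ∀ (m : ℕ) →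
    (pe (suc m) ≡ (m / 2) * po m + pe m) × (po (suc m) ≡ (m / 2) * pe m + po m)
-- pe n and po n unfold to length (paps n 0) and length (paps n 1).
theorem2 m = length-paps-suc m z≤n , length-paps-suc m (s≤s z≤n)
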